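{- Let $n\equiv 0\pmod 4$ and let $\epsilon$ be a positive integer with $\gcd(n,\epsilon)=1$. Then for each integer $\beta$ with $0\leq \beta\leq n-2\epsilon-1$ there exists a Heffter array $H(n;3)$, denoted $L$, with the following properties: (i) the non-empty cells of $L$ are exactly the cells of the diagonals $D_{\beta}$, $D_{\beta+\epsilon}$ and $D_{\beta+2\epsilon}$; (ii) the support of $D_{\beta+\epsilon}$ in $L$ is $\{1,\dots,n\}$ and the support of $D_\beta\cup D_{\beta+2\epsilon}$ in $L$ is $\{n+1,\dots,3n\}$; (iii) all entries of $L$ on $D_{\beta}$ are positive; (iv) all entries of $L$ on $D_{\beta+2\epsilon}$ are negative; (v) the array $M$ defined by $M(i,j)=L(i+1,j+1)$ for $i,j\in\{0,\dots,n-1\}$ (indices modulo $n$) also satisfies properties (i)–(iv) and is a Heffter array $H(n;3)$.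
   Context: A Heffter array $H(n;k)$ is an $n\times n$ array of integers (some cells may be empty) such that: each row and each column contains exactly $k$ filled cells; the entries in every row and every column sum to $0$ modulo $2nk+1$; and for each integer $1\leq x\leq nk$, either $x$ or $-x$ appears in the array. Rows and columns are indexed by $0,\dots,n-1$, with indices computed modulo $n$; $L(i,j)$ denotes the entry in row $i$, column $j$. For $d\in\{0,\dots,n-1\}$ the diagonal $D_d$ is the set of cells $\{(i+d \bmod n,\ i): i=0,\dots,n-1\}$. The support of a set of cells of $L$ is the set of absolute values of the entries of $L$ in those cells. -}

module Defs where

open import Data.Nat as ℕ using (ℕ; zero; suc; NonZero; _%_)
open import Data.Nat.DivMod using (m%n<n)
open import Data.Integer as ℤ using (ℤ; +_; -_; ∣_∣; 0ℤ)
open import Data.Integer.Divisibility using () renaming (_∣_ to _∣ℤ_)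
open import Data.Fin using (Fin; toℕ; fromℕ<)
open import Data.List using (List; map; foldr; length)
open import Data.Nat.ListAction using (sum)
open import Data.List using () renaming (allFin to allFinL)
open import Data.Maybe using (Maybe; just; nothing)
open import Data.Product using (Σ; ∃; ∃-syntax; _×_; _,_)
open import Data.Sum using (_⊎_)
open import Relation.Binary.PropositionalEquality using (_≡_)
open import Function.Bundles using (_⇔_)

-- A partially filled n×n array of integers: nothing = empty cell.
Array : ℕ → Set
Array n = Fin n → Fin n → Maybe ℤ

Filled : Maybe ℤ → Set
Filled m = ∃[ v ] (m ≡ just v)

filled? : Maybe ℤ → ℕ
filled? (just _) = 1
filled? nothing  = 0

val : Maybe ℤ → ℤ
val (just v) = v
val nothing  = 0ℤ

sumℤ : List ℤ → ℤ
sumℤ = foldr ℤ._+_ 0ℤ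

module _ {n : ℕ} (L : Array n) where
  rowCount : Fin n → ℕ
  rowCount i = sum (map (λ j → filled? (L i j)) (allFinL n))

  colCount : Fin n → ℕ
  colCount j = sum (map (λ i → filled? (L i j)) (allFinL n))

  rowSum : Fin n → ℤ
  rowSum i = sumℤ (map (λ j → val (L i j)) (allFinL n))

  colSum : Fin n → ℤ
  colSum j = sumℤ (map (λ i → val (L i j)) (allFinL n))

IsHeffter : (n k : ℕ) → Array n → Set
IsHeffter n k L =
    (∀ i → rowCount L i ≡ k)
  × (∀ j → colCount L j ≡ k)
  × (∀ i → (+ (2 ℕ.* n ℕ.* k ℕ.+ 1)) ∣ℤ rowSum L i)
  × (∀ j → (+ (2 ℕ.* n ℕ.* k ℕ.+ 1)) ∣ℤ colSum L j)
  × (∀ x → 1 ℕ.≤ x → x ℕ.≤ n ℕ.* k →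
       ∃[ i ] ∃[ j ] (L i j ≡ just (+ x) ⊎ L i j ≡ just (- (+ x))))

InDiag : (n : ℕ) .{{_ : NonZero n}} → ℕ → Fin n → Fin n → Set
InDiag n d r c = (toℕ c ℕ.+ d) % n ≡ toℕ r

InSupport : {n : ℕ} → Array n → (Fin n → Fin n → Set) → ℕ → Set
InSupport {n} L S x = ∃[ i ] ∃[ j ] (S i j × ∃[ v ] (L i j ≡ just v × ∣ v ∣ ≡ x))

Props : (n : ℕ) .{{_ : NonZero n}} → (β ε : ℕ) → Array n → Set
Props n β ε L =
    (∀ i j → Filled (L i j) ⇔
        (InDiag n β i j ⊎ InDiag n (β ℕ.+ ε) i j ⊎ InDiag n (β ℕ.+ 2 ℕ.* ε) i j))
  × (∀ x → InSupport L (InDiag n (β ℕ.+ ε)) x ⇔ (1 ℕ.≤ x × x ℕ.≤ n))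
  × (∀ x → InSupport L (λ i j → InDiag n β i j ⊎ InDiag n (β ℕ.+ 2 ℕ.* ε) i j) x
           ⇔ (n ℕ.+ 1 ℕ.≤ x × x ℕ.≤ 3 ℕ.* n))
  × (∀ i j v → InDiag n β i j → L i j ≡ just v → 0ℤ ℤ.< v)
  × (∀ i j v → InDiag n (β ℕ.+ 2 ℕ.* ε) i j → L i j ≡ just v → v ℤ.< 0ℤ)

sucMod : {n : ℕ} .{{_ : NonZero n}} → Fin n → Fin n
sucMod {n} i = fromℕ< (m%n<n (suc (toℕ i)) n)

shift : {n : ℕ} .{{_ : NonZero n}} → Array n → Array n
shift L i j = L (sucMod i) (sucMod j)

-- Write n = 4q and T = 4n + 1. The zigzag u = n, 1, n - 1, 2, … is a permutation of [1, n] whose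
-- consecutive differences are n - 1, n - 2, …, 1. Lift each u_k to A_k ∈ {n + u_k, 3n + 1 - u_k},
-- taking the high member on the even positions below 2q - 1 and on the odd positions from 2q - 1
-- on. Then the pairs {A_k, T - A_k} exhaust [n + 1, 3n], and the cyclic gaps |T - A_k - A_(k+1)|
-- are n - 1 - k except for n at k = 2q - 2 and 2q + 1 at k = n - 1, so they exhaust [1, n].
-- Label column c by k = c ε⁻¹ mod n and put A_k, T - A_k - A_(k+1) and A_(k+1) - T on D_β, D_(β+ε)
-- and D_(β+2ε). Every column sums to 0, and so does every row, because moving ε columns to the
-- left lowers the label by one. Shifting the array by (1, 1) merely relabels the columns, so M
-- arises from the same construction.

module Submission where

open import Defs
open import Level using (0ℓ)
open import Algebra.Bundles using (CommutativeMonoid)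
open import Data.Bool using (Bool; true; false; not; if_then_else_)
open import Data.Empty using (⊥-elim)
open import Data.Nat as ℕ
  using (ℕ; zero; suc; pred; NonZero; _+_; _*_; _∸_; _%_; _<_; _≤_; _<?_; _≤?_; z≤n; s≤s)
import Data.Nat.Properties as ℕ
open import Data.Nat.DivMod
  using (%-distribˡ-+; %-distribˡ-*; [m+n]%n≡m%n; [m+kn]%n≡m%n; m%n<n; m%n%n≡m%n; m<n⇒m%n≡m; n%n≡0)
open import Data.Nat.Divisibility using (_∣_; divides; _∣0)
open import Data.Nat.GCD using (gcd; gcd-GCD; GCD; module Bézout)
open import Data.Nat.Tactic.RingSolver using (solve-∀)
open import Data.Integer as ℤ using (ℤ; +_; -_; ∣_∣; 0ℤ; -[1+_]; +<+; -<+)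
import Data.Integer.Properties as ℤ
import Data.Integer.Tactic.RingSolver as ℤ-Solver
open import Data.Integer.Divisibility using () renaming (_∣_ to _∣ℤ_)
open import Data.Fin using (Fin; toℕ; fromℕ<)
import Data.Fin.Properties as Fin
open import Data.Fin.Properties using (toℕ-fromℕ<; toℕ<n; toℕ-injective)
open import Data.List using (foldr; map; tabulate; allFin)
open import Data.List.Properties using (map-tabulate)
open import Data.Maybe using (Maybe; just; nothing)
open import Data.Maybe.Properties using (just-injective)
open import Data.Product using (_×_; _,_; proj₁; proj₂; ∃-syntax)
open import Data.Sum as Sum using (_⊎_; inj₁; inj₂; swap)
open import Data.Vec.Functional using (Vector)
open import Function using (_∘_; id; flip; _⇔_; mk⇔; Equivalence)
open import Relation.Nullary using (Dec; ¬_; does; yes; no)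
open import Relation.Binary.PropositionalEquality as ≡
  using (_≡_; _≢_; refl; cong; cong₂; sym; trans; subst; module ≡-Reasoning)

module SmallSupport (M : CommutativeMonoid 0ℓ 0ℓ) where

  open CommutativeMonoid M
    renaming (ε to 0#; refl to ≈-refl; sym to ≈-sym; trans to ≈-trans)
  open import Algebra.Properties.CommutativeMonoid.Sum M using (sum; sum-cong-≋; sum-replicate-zero)
  open import Algebra.Properties.CommutativeSemigroup commutativeSemigroup using (x∙yz≈y∙xz)
  open import Relation.Binary.Reasoning.Setoid setoid
  open import Data.Fin using (zero; suc)

  erase : ∀ {n} → Fin n → Vector Carrier n → Vector Carrier n
  erase i f j = if does (j Fin.≟ i) then 0# else f j

  erase-≢ : ∀ {n} {i j : Fin n} (f : Vector Carrier n) → j ≢ i → erase i f j ≡ f j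
  erase-≢ {i = i} {j} f j≢i with j Fin.≟ i
  ... | yes j≡i = ⊥-elim (j≢i j≡i)
  ... | no _    = refl

  sum-zeros : ∀ {n} (f : Vector Carrier n) → (∀ i → f i ≈ 0#) → sum f ≈ 0#
  sum-zeros {n} f f≈0 = ≈-trans (sum-cong-≋ f≈0) (sum-replicate-zero n)

  sum-erase : ∀ {n} (f : Vector Carrier n) i → sum f ≈ f i ∙ sum (erase i f)
  sum-erase f zero    = ∙-congˡ (≈-sym (identityˡ _))
  sum-erase f (suc i) = begin
    f zero ∙ sum (f ∘ suc)                          ≈⟨ ∙-congˡ (sum-erase (f ∘ suc) i) ⟩
    f zero ∙ (f (suc i) ∙ sum (erase i (f ∘ suc)))  ≈⟨ x∙yz≈y∙xz _ _ _ ⟩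
    f (suc i) ∙ (f zero ∙ sum (erase i (f ∘ suc)))  ∎

  sum-three : ∀ {n} (f : Vector Carrier n) a b c → a ≢ b → a ≢ c → b ≢ c →
              (∀ j → j ≢ a → j ≢ b → j ≢ c → f j ≈ 0#) → sum f ≈ f a ∙ (f b ∙ f c)
  sum-three f a b c a≢b a≢c b≢c outside = begin
    sum f                                     ≈⟨ sum-erase f a ⟩
    f a ∙ sum f₁                              ≈⟨ ∙-congˡ (sum-erase f₁ b) ⟩
    f a ∙ (f₁ b ∙ sum f₂)                     ≈⟨ ∙-congˡ (∙-congˡ (sum-erase f₂ c)) ⟩
    f a ∙ (f₁ b ∙ (f₂ c ∙ sum (erase c f₂)))  ≈⟨ ∙-congˡ (∙-congˡ (∙-congˡ (sum-zeros _ vanish))) ⟩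
    f a ∙ (f₁ b ∙ (f₂ c ∙ 0#))                ≈⟨ ∙-congˡ (∙-congˡ (identityʳ _)) ⟩
    f a ∙ (f₁ b ∙ f₂ c)                       ≡⟨ cong₂ (λ x y → f a ∙ (x ∙ y)) f₁b≡fb f₂c≡fc ⟩
    f a ∙ (f b ∙ f c)                         ∎
    where
    f₁ f₂ : Vector Carrier _
    f₁ = erase a f
    f₂ = erase b f₁
    f₁b≡fb : f₁ b ≡ f b
    f₁b≡fb = erase-≢ f (a≢b ∘ sym)
    f₂c≡fc : f₂ c ≡ f c
    f₂c≡fc = trans (erase-≢ f₁ (b≢c ∘ sym)) (erase-≢ f (a≢c ∘ sym))
    vanish : ∀ j → erase c f₂ j ≈ 0#
    vanish j with j Fin.≟ c | j Fin.≟ b | j Fin.≟ a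
    ... | yes _  | _      | _      = ≈-refl
    ... | no _   | yes _  | _      = ≈-refl
    ... | no _   | no _   | yes _  = ≈-refl
    ... | no j≢c | no j≢b | no j≢a = outside j j≢a j≢b j≢c

  foldr-allFin : ∀ {n} (f : Vector Carrier n) → foldr _∙_ 0# (map f (allFin n)) ≡ sum f
  foldr-allFin {n} f = trans (cong (foldr _∙_ 0#) (map-tabulate id f)) (foldr-tabulate f)
    where
    foldr-tabulate : ∀ {m} (g : Vector Carrier m) → foldr _∙_ 0# (tabulate g) ≡ sum g
    foldr-tabulate {zero}  g = refl
    foldr-tabulate {suc m} g = cong (g zero ∙_) (foldr-tabulate (g ∘ suc))

module Modular (n : ℕ) .{{_ : NonZero n}} where

  open ≡-Reasoning

  %-addʳ : ∀ {a b} c → a % n ≡ b % n → (a + c) % n ≡ (b + c) % n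
  %-addʳ {a} {b} c a≡b = begin
    (a + c) % n            ≡⟨ %-distribˡ-+ a c n ⟩
    (a % n + c % n) % n    ≡⟨ cong (λ x → (x + c % n) % n) a≡b ⟩
    (b % n + c % n) % n    ≡⟨ %-distribˡ-+ b c n ⟨
    (b + c) % n            ∎

  %-addˡ : ∀ {a b} c → a % n ≡ b % n → (c + a) % n ≡ (c + b) % n
  %-addˡ {a} {b} c a≡b = begin
    (c + a) % n  ≡⟨ cong (_% n) (ℕ.+-comm c a) ⟩
    (a + c) % n  ≡⟨ %-addʳ c a≡b ⟩
    (b + c) % n  ≡⟨ cong (_% n) (ℕ.+-comm b c) ⟩
    (c + b) % n  ∎

  %-mulʳ : ∀ {a b} c → a % n ≡ b % n → (a * c) % n ≡ (b * c) % n
  %-mulʳ {a} {b} c a≡b = begin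
    (a * c) % n            ≡⟨ %-distribˡ-* a c n ⟩
    (a % n * (c % n)) % n  ≡⟨ cong (λ x → (x * (c % n)) % n) a≡b ⟩
    (b % n * (c % n)) % n  ≡⟨ %-distribˡ-* b c n ⟨
    (b * c) % n            ∎

  [m+d+pred[n]*d]%n≡m%n : ∀ a d → (a + d + pred n * d) % n ≡ a % n
  [m+d+pred[n]*d]%n≡m%n a d = begin
    (a + d + pred n * d) % n      ≡⟨ cong (_% n) (ℕ.+-assoc a d _) ⟩
    (a + suc (pred n) * d) % n    ≡⟨ cong (λ m → (a + m * d) % n) (ℕ.suc-pred n) ⟩
    (a + n * d) % n               ≡⟨ cong (λ m → (a + m) % n) (ℕ.*-comm n d) ⟩
    (a + d * n) % n               ≡⟨ [m+kn]%n≡m%n a d n ⟩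
    a % n                         ∎

  %-cancelʳ-+ : ∀ {a b} d → (a + d) % n ≡ (b + d) % n → a % n ≡ b % n
  %-cancelʳ-+ {a} {b} d h = begin
    a % n                     ≡⟨ [m+d+pred[n]*d]%n≡m%n a d ⟨
    (a + d + pred n * d) % n  ≡⟨ %-addʳ (pred n * d) h ⟩
    (b + d + pred n * d) % n  ≡⟨ [m+d+pred[n]*d]%n≡m%n b d ⟩
    b % n                     ∎

  toℕ-sucMod : ∀ (c : Fin n) → toℕ (sucMod c) ≡ suc (toℕ c) % n
  toℕ-sucMod c = toℕ-fromℕ< (m%n<n (suc (toℕ c)) n)

  toℕ-sucMod-+ : ∀ d c → (toℕ (sucMod c) + d) % n ≡ suc ((toℕ c + d) % n) % n
  toℕ-sucMod-+ d c = begin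
    (toℕ (sucMod c) + d) % n       ≡⟨ cong (λ x → (x + d) % n) (toℕ-sucMod c) ⟩
    (suc (toℕ c) % n + d) % n      ≡⟨ %-addʳ d (m%n%n≡m%n (suc (toℕ c)) n) ⟩
    suc (toℕ c + d) % n            ≡⟨ %-addˡ 1 (m%n%n≡m%n (toℕ c + d) n) ⟨
    suc ((toℕ c + d) % n) % n      ∎

module Diagonal (n : ℕ) .{{_ : NonZero n}} where

  open Modular n
  open ≡-Reasoning

  InDiag? : ∀ d r c → Dec (InDiag n d r c)
  InDiag? d r c = (toℕ c + d) % n ℕ.≟ toℕ r

  diagRow : ℕ → Fin n → Fin n
  diagRow d c = fromℕ< (m%n<n (toℕ c + d) n)

  InDiag-diagRow : ∀ d c → InDiag n d (diagRow d c) c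
  InDiag-diagRow d c = sym (toℕ-fromℕ< (m%n<n (toℕ c + d) n))

  InDiag⇒≡diagRow : ∀ {d r c} → InDiag n d r c → r ≡ diagRow d c
  InDiag⇒≡diagRow {d} {r} {c} h = toℕ-injective (trans (sym h) (InDiag-diagRow d c))

  -- the column of D_d in row r is r - d, computed as r + (n - 1) d
  diagCol : ℕ → Fin n → Fin n
  diagCol d r = fromℕ< (m%n<n (toℕ r + pred n * d) n)

  InDiag-diagCol : ∀ d r → InDiag n d r (diagCol d r)
  InDiag-diagCol d r = begin
    (toℕ (diagCol d r) + d) % n       ≡⟨ cong (λ x → (x + d) % n) (toℕ-fromℕ< (m%n<n x n)) ⟩
    (x % n + d) % n                   ≡⟨ %-addʳ d (m%n%n≡m%n x n) ⟩
    (x + d) % n                       ≡⟨ cong (_% n) (reorder (toℕ r) d (pred n * d)) ⟩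
    (toℕ r + d + pred n * d) % n      ≡⟨ [m+d+pred[n]*d]%n≡m%n (toℕ r) d ⟩
    toℕ r % n                         ≡⟨ m<n⇒m%n≡m (toℕ<n r) ⟩
    toℕ r                             ∎
    where
    x = toℕ r + pred n * d
    reorder : ∀ a b c → a + c + b ≡ a + b + c
    reorder = solve-∀

  InDiag⇒≡diagCol : ∀ {d r c} → InDiag n d r c → c ≡ diagCol d r
  InDiag⇒≡diagCol {d} {r} {c} h = toℕ-injective (begin
    toℕ c          ≡⟨ m<n⇒m%n≡m (toℕ<n c) ⟨
    toℕ c % n      ≡⟨ %-cancelʳ-+ d (trans h (sym (InDiag-diagCol d r))) ⟩
    toℕ c′ % n     ≡⟨ m<n⇒m%n≡m (toℕ<n c′) ⟩
    toℕ c′         ∎)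
    where c′ = diagCol d r

  InDiag-disjoint : ∀ {d e r c} → 0 < e → e < n → InDiag n d r c → ¬ InDiag n (d + e) r c
  InDiag-disjoint {d} {e} {r} {c} 0<e e<n on-d on-d+e = ℕ.<-irrefl e≡0 0<e
    where
    shifted : (e + (toℕ c + d)) % n ≡ (0 + (toℕ c + d)) % n
    shifted = trans (cong (_% n) (reorder (toℕ c) d e)) (trans on-d+e (sym on-d))
      where reorder : ∀ c d e → e + (c + d) ≡ c + (d + e)
            reorder = solve-∀
    e≡0 : 0 ≡ e
    e≡0 = begin
      0      ≡⟨ m<n⇒m%n≡m (ℕ.>-nonZero⁻¹ n) ⟨
      0 % n  ≡⟨ %-cancelʳ-+ (toℕ c + d) shifted ⟨
      e % n  ≡⟨ m<n⇒m%n≡m e<n ⟩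
      e      ∎

  InDiag-step : ∀ {d e r c c′} → InDiag n (d + e) r c → InDiag n d r c′ → (toℕ c + e) % n ≡ toℕ c′
  InDiag-step {d} {e} {r} {c} {c′} on-d+e on-d = trans (%-cancelʳ-+ d moved) (m<n⇒m%n≡m (toℕ<n c′))
    where
    moved : (toℕ c + e + d) % n ≡ (toℕ c′ + d) % n
    moved = trans (cong (_% n) (reorder (toℕ c) e d)) (trans on-d+e (sym on-d))
      where reorder : ∀ c e d → c + e + d ≡ c + (d + e)
            reorder = solve-∀

  InDiag-sucMod⁺ : ∀ {d r c} → InDiag n d r c → InDiag n d (sucMod r) (sucMod c)
  InDiag-sucMod⁺ {d} {r} {c} h =
    trans (toℕ-sucMod-+ d c) (trans (cong (λ x → suc x % n) h) (sym (toℕ-sucMod r)))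

  InDiag-sucMod⁻ : ∀ {d r c} → InDiag n d (sucMod r) (sucMod c) → InDiag n d r c
  InDiag-sucMod⁻ {d} {r} {c} h = begin
    (toℕ c + d) % n            ≡⟨ m%n%n≡m%n (toℕ c + d) n ⟨
    (toℕ c + d) % n % n        ≡⟨ %-cancelʳ-+ 1 shifted ⟩
    toℕ r % n                  ≡⟨ m<n⇒m%n≡m (toℕ<n r) ⟩
    toℕ r                      ∎
    where
    shifted : ((toℕ c + d) % n + 1) % n ≡ (toℕ r + 1) % n
    shifted = begin
      ((toℕ c + d) % n + 1) % n  ≡⟨ cong (_% n) (ℕ.+-comm _ 1) ⟩
      suc ((toℕ c + d) % n) % n  ≡⟨ toℕ-sucMod-+ d c ⟨
      (toℕ (sucMod c) + d) % n   ≡⟨ h ⟩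
      toℕ (sucMod r)             ≡⟨ toℕ-sucMod r ⟩
      suc (toℕ r) % n            ≡⟨ cong (_% n) (ℕ.+-comm 1 (toℕ r)) ⟩
      (toℕ r + 1) % n            ∎

  sucMod-onto : ∀ k → ∃[ c ] sucMod c ≡ k
  sucMod-onto k = c , toℕ-injective (begin
    toℕ (sucMod c)       ≡⟨ toℕ-sucMod c ⟩
    suc (toℕ c) % n      ≡⟨ cong (_% n) (ℕ.+-comm 1 (toℕ c)) ⟩
    (toℕ c + 1) % n      ≡⟨ InDiag-diagCol 1 k ⟩
    toℕ k                ∎)
    where c = diagCol 1 k

pairSum : ℕ → ℕ
pairSum n = 4 * n + 1

pos-∸ : ∀ {m k} → k ≤ m → + (m ∸ k) ≡ + m ℤ.- + k
pos-∸ {m} {k} k≤m = sym (trans (ℤ.m-n≡m⊖n m k) (ℤ.⊖-≥ k≤m))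

column-cancels : ∀ t x y → y ≤ t → + x ℤ.+ ((+ t ℤ.- + x ℤ.- + y) ℤ.+ - + (t ∸ y)) ≡ 0ℤ
column-cancels t x y y≤t rewrite pos-∸ y≤t = identity (+ t) (+ x) (+ y)
  where identity : ∀ t x y → x ℤ.+ ((t ℤ.- x ℤ.- y) ℤ.+ ℤ.- (t ℤ.- y)) ≡ 0ℤ
        identity = ℤ-Solver.solve-∀

row-cancels : ∀ t x y → x ≤ t → + y ℤ.+ ((+ t ℤ.- + x ℤ.- + y) ℤ.+ - + (t ∸ x)) ≡ 0ℤ
row-cancels t x y x≤t rewrite pos-∸ x≤t = identity (+ t) (+ x) (+ y)
  where identity : ∀ t x y → y ℤ.+ ((t ℤ.- x ℤ.- y) ℤ.+ ℤ.- (t ℤ.- x)) ≡ 0ℤ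
        identity = ℤ-Solver.solve-∀

∣i∣≡x⇒i≡±x : ∀ i x → ∣ i ∣ ≡ x → i ≡ + x ⊎ i ≡ - + x
∣i∣≡x⇒i≡±x (+ m)    x refl = inj₁ refl
∣i∣≡x⇒i≡±x -[1+ m ] x refl = inj₂ refl

module _ (n : ℕ) .{{_ : NonZero n}} where

  gap : (Fin n → ℕ) → Fin n → ℤ
  gap A k = + pairSum n ℤ.- + A k ℤ.- + A (sucMod k)

  mirror : (Fin n → ℕ) → Fin n → ℕ
  mirror A k = pairSum n ∸ A (sucMod k)

  record IsHeffterSeed (A : Fin n → ℕ) : Set where
    field
      range      : ∀ k → n + 1 ≤ A k × A k ≤ 3 * n
      gap-range  : ∀ k → 1 ≤ ∣ gap A k ∣ × ∣ gap A k ∣ ≤ n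
      gap-onto   : ∀ x → 1 ≤ x → x ≤ n → ∃[ k ] ∣ gap A k ∣ ≡ x
      pairs-onto : ∀ x → n + 1 ≤ x → x ≤ 3 * n → ∃[ k ] (A k ≡ x ⊎ A k + x ≡ pairSum n)

  record IsLabelling (ε : ℕ) (κ : Fin n → Fin n) : Set where
    field
      step : ∀ c c′ → (toℕ c + ε) % n ≡ toℕ c′ → κ c′ ≡ sucMod (κ c)
      onto : ∀ k → ∃[ c ] κ c ≡ k

  record IsLayout (β ε : ℕ) (A : Fin n → ℕ) (κ : Fin n → Fin n) (L : Array n) : Set where
    field
      on-D₀ : ∀ {r c} → InDiag n β r c → L r c ≡ just (+ A (κ c))
      on-D₁ : ∀ {r c} → InDiag n (β + ε) r c → L r c ≡ just (gap A (κ c))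
      on-D₂ : ∀ {r c} → InDiag n (β + 2 * ε) r c → L r c ≡ just (- + mirror A (κ c))
      off   : ∀ {r c} → ¬ InDiag n β r c → ¬ InDiag n (β + ε) r c → ¬ InDiag n (β + 2 * ε) r c →
              L r c ≡ nothing

  open Modular n
  open Diagonal n

  layout : (β ε : ℕ) (A : Fin n → ℕ) (κ : Fin n → Fin n) → Array n
  layout β ε A κ r c with InDiag? β r c | InDiag? (β + ε) r c | InDiag? (β + 2 * ε) r c
  ... | yes _ | _     | _     = just (+ A (κ c))
  ... | no _  | yes _ | _     = just (gap A (κ c))
  ... | no _  | no _  | yes _ = just (- + mirror A (κ c))
  ... | no _  | no _  | no _  = nothing

  module DisjointDiagonals {β ε : ℕ} (0<ε : 0 < ε) (bound : β + 2 * ε + 1 ≤ n) where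

    2ε<n : 2 * ε < n
    2ε<n = ℕ.≤-trans (s≤s (ℕ.m≤n+m (2 * ε) β)) (subst (_≤ n) (ℕ.+-comm (β + 2 * ε) 1) bound)

    ε<n : ε < n
    ε<n = ℕ.≤-<-trans (ℕ.m≤m+n ε (ε + 0)) 2ε<n

    β+2ε≡β+ε+ε : β + 2 * ε ≡ β + ε + ε
    β+2ε≡β+ε+ε = rearrange β ε
      where rearrange : ∀ b e → b + 2 * e ≡ b + e + e
            rearrange = solve-∀

    D₀∩D₁ : ∀ {r c} → InDiag n β r c → ¬ InDiag n (β + ε) r c
    D₀∩D₁ {r} {c} = InDiag-disjoint {β} {ε} {r} {c} 0<ε ε<n

    D₁∩D₂ : ∀ {r c} → InDiag n (β + ε) r c → ¬ InDiag n (β + 2 * ε) r c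
    D₁∩D₂ {r} {c} p q =
      InDiag-disjoint {β + ε} {ε} {r} {c} 0<ε ε<n p (subst (λ d → InDiag n d r c) β+2ε≡β+ε+ε q)

    D₀∩D₂ : ∀ {r c} → InDiag n β r c → ¬ InDiag n (β + 2 * ε) r c
    D₀∩D₂ {r} {c} = InDiag-disjoint {β} {2 * ε} {r} {c} (ℕ.≤-trans 0<ε (ℕ.m≤m+n ε (ε + 0))) 2ε<n

    layout-IsLayout : ∀ A κ → IsLayout β ε A κ (layout β ε A κ)
    layout-IsLayout A κ = record { on-D₀ = D₀ ; on-D₁ = D₁ ; on-D₂ = D₂ ; off = off }
      where
      D₀ : ∀ {r c} → InDiag n β r c → layout β ε A κ r c ≡ just (+ A (κ c))
      D₀ {r} {c} p with InDiag? β r c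
      ... | yes _ = refl
      ... | no ¬p = ⊥-elim (¬p p)
      D₁ : ∀ {r c} → InDiag n (β + ε) r c → layout β ε A κ r c ≡ just (gap A (κ c))
      D₁ {r} {c} p with InDiag? β r c | InDiag? (β + ε) r c
      ... | yes p₀ | _     = ⊥-elim (D₀∩D₁ p₀ p)
      ... | no _   | yes _ = refl
      ... | no _   | no ¬p = ⊥-elim (¬p p)
      D₂ : ∀ {r c} → InDiag n (β + 2 * ε) r c → layout β ε A κ r c ≡ just (- + mirror A (κ c))
      D₂ {r} {c} p with InDiag? β r c | InDiag? (β + ε) r c | InDiag? (β + 2 * ε) r c
      ... | yes p₀ | _      | _     = ⊥-elim (D₀∩D₂ p₀ p)
      ... | no _   | yes p₁ | _     = ⊥-elim (D₁∩D₂ {r} {c} p₁ p)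
      ... | no _   | no _   | yes _ = refl
      ... | no _   | no _   | no ¬p = ⊥-elim (¬p p)
      off : ∀ {r c} → ¬ InDiag n β r c → ¬ InDiag n (β + ε) r c → ¬ InDiag n (β + 2 * ε) r c →
            layout β ε A κ r c ≡ nothing
      off {r} {c} ¬p₀ ¬p₁ ¬p₂ with InDiag? β r c | InDiag? (β + ε) r c | InDiag? (β + 2 * ε) r c
      ... | yes p₀ | _      | _      = ⊥-elim (¬p₀ p₀)
      ... | no _   | yes p₁ | _      = ⊥-elim (¬p₁ p₁)
      ... | no _   | no _   | yes p₂ = ⊥-elim (¬p₂ p₂)
      ... | no _   | no _   | no _   = refl

  IsLayout-shift : ∀ {β ε A κ L} → IsLayout β ε A κ L → IsLayout β ε A (κ ∘ sucMod) (shift L)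
  IsLayout-shift {β} {ε} lay = record
    { on-D₀ = λ {r} {c} p → on-D₀ (InDiag-sucMod⁺ {β} {r} {c} p)
    ; on-D₁ = λ {r} {c} p → on-D₁ (InDiag-sucMod⁺ {β + ε} {r} {c} p)
    ; on-D₂ = λ {r} {c} p → on-D₂ (InDiag-sucMod⁺ {β + 2 * ε} {r} {c} p)
    ; off   = λ {r} {c} ¬p₀ ¬p₁ ¬p₂ →
        off (¬p₀ ∘ InDiag-sucMod⁻ {β} {r} {c}) (¬p₁ ∘ InDiag-sucMod⁻ {β + ε} {r} {c})
            (¬p₂ ∘ InDiag-sucMod⁻ {β + 2 * ε} {r} {c})
    }
    where open IsLayout lay

  IsLabelling-shift : ∀ {ε κ} → IsLabelling ε κ → IsLabelling ε (κ ∘ sucMod)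
  IsLabelling-shift {ε} {κ} lab = record
    { step = λ c c′ h → step (sucMod c) (sucMod c′)
               (trans (toℕ-sucMod-+ ε c) (trans (cong (λ x → suc x % n) h) (sym (toℕ-sucMod c′))))
    ; onto = λ k → let (c , κc≡k) = onto k ; (c₀ , c₀+1≡c) = sucMod-onto c
                   in c₀ , trans (cong κ c₀+1≡c) κc≡k
    }
    where open IsLabelling lab

  pairSum∸-range : ∀ {a} → n + 1 ≤ a × a ≤ 3 * n → n + 1 ≤ pairSum n ∸ a × pairSum n ∸ a ≤ 3 * n
  pairSum∸-range {a} (n+1≤a , a≤3n) = lower , upper
    where
    open ℕ.≤-Reasoning
    split : pairSum n ≡ n + 1 + 3 * n
    split = rearrange n
      where rearrange : ∀ n → 4 * n + 1 ≡ n + 1 + 3 * n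
            rearrange = solve-∀
    lower : n + 1 ≤ pairSum n ∸ a
    lower = begin
      n + 1                  ≡⟨ ℕ.m+n∸n≡m (n + 1) (3 * n) ⟨
      n + 1 + 3 * n ∸ 3 * n  ≡⟨ cong (_∸ 3 * n) split ⟨
      pairSum n ∸ 3 * n      ≤⟨ ℕ.∸-monoʳ-≤ (pairSum n) a≤3n ⟩
      pairSum n ∸ a          ∎
    upper : pairSum n ∸ a ≤ 3 * n
    upper = begin
      pairSum n ∸ a          ≤⟨ ℕ.∸-monoʳ-≤ (pairSum n) n+1≤a ⟩
      pairSum n ∸ (n + 1)    ≡⟨ cong (_∸ (n + 1)) split ⟩
      n + 1 + 3 * n ∸ (n + 1) ≡⟨ ℕ.m+n∸m≡n (n + 1) (3 * n) ⟩
      3 * n                  ∎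

  range⇒≤pairSum : ∀ {a} → a ≤ 3 * n → a ≤ pairSum n
  range⇒≤pairSum a≤3n =
    ℕ.≤-trans a≤3n (ℕ.≤-trans (ℕ.*-monoˡ-≤ n (ℕ.m≤n+m 3 1)) (ℕ.m≤m+n (4 * n) 1))

  module LayoutProperties {β ε : ℕ} {A : Fin n → ℕ} {κ : Fin n → Fin n} {L : Array n}
    (0<ε : 0 < ε) (bound : β + 2 * ε + 1 ≤ n)
    (seed : IsHeffterSeed A) (lab : IsLabelling ε κ) (lay : IsLayout β ε A κ L) where

    open DisjointDiagonals {β} {ε} 0<ε bound
    open IsHeffterSeed seed
    open IsLabelling lab
    open IsLayout lay

    A≤pairSum : ∀ k → A k ≤ pairSum n
    A≤pairSum k = range⇒≤pairSum (proj₂ (range k))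

    column-balance : ∀ k → + A k ℤ.+ (gap A k ℤ.+ - + mirror A k) ≡ 0ℤ
    column-balance k = column-cancels (pairSum n) (A k) (A (sucMod k)) (A≤pairSum (sucMod k))

    row-balance : ∀ {k₀ k₁ k₂} → k₀ ≡ sucMod k₁ → sucMod k₂ ≡ k₁ →
                  + A k₀ ℤ.+ (gap A k₁ ℤ.+ - + mirror A k₂) ≡ 0ℤ
    row-balance {k₂ = k₂} refl refl =
      row-cancels (pairSum n) (A (sucMod k₂)) (A (sucMod (sucMod k₂))) (A≤pairSum (sucMod k₂))

    module Row (r : Fin n) where
      c₀ c₁ c₂ : Fin n
      c₀ = diagCol β r
      c₁ = diagCol (β + ε) r
      c₂ = diagCol (β + 2 * ε) r

      p₀ : InDiag n β r c₀
      p₀ = InDiag-diagCol β r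
      p₁ : InDiag n (β + ε) r c₁
      p₁ = InDiag-diagCol (β + ε) r
      p₂ : InDiag n (β + 2 * ε) r c₂
      p₂ = InDiag-diagCol (β + 2 * ε) r

      c₀≢c₁ : c₀ ≢ c₁
      c₀≢c₁ eq = D₀∩D₁ {r} {c₀} p₀ (subst (InDiag n (β + ε) r) (sym eq) p₁)
      c₀≢c₂ : c₀ ≢ c₂
      c₀≢c₂ eq = D₀∩D₂ {r} {c₀} p₀ (subst (InDiag n (β + 2 * ε) r) (sym eq) p₂)
      c₁≢c₂ : c₁ ≢ c₂
      c₁≢c₂ eq = D₁∩D₂ {r} {c₁} p₁ (subst (InDiag n (β + 2 * ε) r) (sym eq) p₂)

      elsewhere : ∀ j → j ≢ c₀ → j ≢ c₁ → j ≢ c₂ → L r j ≡ nothing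
      elsewhere j j≢c₀ j≢c₁ j≢c₂ =
        off (j≢c₀ ∘ InDiag⇒≡diagCol {β} {r} {j}) (j≢c₁ ∘ InDiag⇒≡diagCol {β + ε} {r} {j})
            (j≢c₂ ∘ InDiag⇒≡diagCol {β + 2 * ε} {r} {j})

      labels : κ c₀ ≡ sucMod (κ c₁) × sucMod (κ c₂) ≡ κ c₁
      labels = step c₁ c₀ (InDiag-step {β} {ε} {r} {c₁} {c₀} p₁ p₀) ,
               sym (step c₂ c₁ (InDiag-step {β + ε} {ε} {r} {c₂} {c₁}
                                  (subst (λ d → InDiag n d r c₂) β+2ε≡β+ε+ε p₂) p₁))

    module Column (c : Fin n) where
      r₀ r₁ r₂ : Fin n
      r₀ = diagRow β c
      r₁ = diagRow (β + ε) c
      r₂ = diagRow (β + 2 * ε) c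

      p₀ : InDiag n β r₀ c
      p₀ = InDiag-diagRow β c
      p₁ : InDiag n (β + ε) r₁ c
      p₁ = InDiag-diagRow (β + ε) c
      p₂ : InDiag n (β + 2 * ε) r₂ c
      p₂ = InDiag-diagRow (β + 2 * ε) c

      r₀≢r₁ : r₀ ≢ r₁
      r₀≢r₁ eq = D₀∩D₁ {r₀} {c} p₀ (subst (λ x → InDiag n (β + ε) x c) (sym eq) p₁)
      r₀≢r₂ : r₀ ≢ r₂
      r₀≢r₂ eq = D₀∩D₂ {r₀} {c} p₀ (subst (λ x → InDiag n (β + 2 * ε) x c) (sym eq) p₂)
      r₁≢r₂ : r₁ ≢ r₂
      r₁≢r₂ eq = D₁∩D₂ {r₁} {c} p₁ (subst (λ x → InDiag n (β + 2 * ε) x c) (sym eq) p₂)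

      elsewhere : ∀ i → i ≢ r₀ → i ≢ r₁ → i ≢ r₂ → L i c ≡ nothing
      elsewhere i i≢r₀ i≢r₁ i≢r₂ =
        off (i≢r₀ ∘ InDiag⇒≡diagRow {β} {i} {c}) (i≢r₁ ∘ InDiag⇒≡diagRow {β + ε} {i} {c})
            (i≢r₂ ∘ InDiag⇒≡diagRow {β + 2 * ε} {i} {c})

    module Along (M : CommutativeMonoid 0ℓ 0ℓ) (f : Maybe ℤ → CommutativeMonoid.Carrier M)
                 (f-nothing : f nothing ≡ CommutativeMonoid.ε M) where
      open CommutativeMonoid M using (_≈_; _∙_; reflexive) renaming (ε to 0#; trans to ≈-trans)
      open SmallSupport M using (sum-three; foldr-allFin)

      along-row : ∀ r → let open Row r in
        foldr _∙_ 0# (map (f ∘ L r) (allFin n))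
          ≈ f (just (+ A (κ c₀))) ∙ (f (just (gap A (κ c₁))) ∙ f (just (- + mirror A (κ c₂))))
      along-row r = ≈-trans (reflexive (foldr-allFin (f ∘ L r))) (≈-trans
        (sum-three (f ∘ L r) c₀ c₁ c₂ c₀≢c₁ c₀≢c₂ c₁≢c₂
          (λ j j≢c₀ j≢c₁ j≢c₂ → reflexive (trans (cong f (elsewhere j j≢c₀ j≢c₁ j≢c₂)) f-nothing)))
        (reflexive (cong₂ _∙_ (cong f (on-D₀ p₀)) (cong₂ _∙_ (cong f (on-D₁ p₁)) (cong f (on-D₂ p₂))))))
        where open Row r

      along-column : ∀ c → let open Column c in
        foldr _∙_ 0# (map (λ i → f (L i c)) (allFin n))
          ≈ f (just (+ A (κ c))) ∙ (f (just (gap A (κ c))) ∙ f (just (- + mirror A (κ c))))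
      along-column c = ≈-trans (reflexive (foldr-allFin (λ i → f (L i c)))) (≈-trans
        (sum-three (λ i → f (L i c)) r₀ r₁ r₂ r₀≢r₁ r₀≢r₂ r₁≢r₂
          (λ i i≢r₀ i≢r₁ i≢r₂ → reflexive (trans (cong f (elsewhere i i≢r₀ i≢r₁ i≢r₂)) f-nothing)))
        (reflexive (cong₂ _∙_ (cong f (on-D₀ p₀)) (cong₂ _∙_ (cong f (on-D₁ p₁)) (cong f (on-D₂ p₂))))))
        where open Column c

    module Count = Along ℕ.+-0-commutativeMonoid filled? refl
    module Total = Along ℤ.+-0-commutativeMonoid val refl

    rowCount≡3 : ∀ r → rowCount L r ≡ 3
    rowCount≡3 = Count.along-row

    colCount≡3 : ∀ c → colCount L c ≡ 3
    colCount≡3 = Count.along-column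

    rowSum≡0 : ∀ r → rowSum L r ≡ 0ℤ
    rowSum≡0 r = trans (Total.along-row r) (row-balance (proj₁ labels) (proj₂ labels))
      where open Row r

    colSum≡0 : ∀ c → colSum L c ≡ 0ℤ
    colSum≡0 c = trans (Total.along-column c) (column-balance (κ c))

    entry-unique : ∀ {r c v w} → L r c ≡ just v → L r c ≡ just w → v ≡ w
    entry-unique p q = just-injective (trans (sym p) q)

    support-D₁ : ∀ x → InSupport L (InDiag n (β + ε)) x ⇔ (1 ≤ x × x ≤ n)
    support-D₁ x = mk⇔ to from
      where
      to : InSupport L (InDiag n (β + ε)) x → 1 ≤ x × x ≤ n
      to (r , c , p , v , Lrc≡v , ∣v∣≡x) = subst (λ y → 1 ≤ y × y ≤ n) ∣gap∣≡x (gap-range (κ c))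
        where ∣gap∣≡x : ∣ gap A (κ c) ∣ ≡ x
              ∣gap∣≡x = trans (cong ∣_∣ (entry-unique (on-D₁ p) Lrc≡v)) ∣v∣≡x
      from : 1 ≤ x × x ≤ n → InSupport L (InDiag n (β + ε)) x
      from (1≤x , x≤n) =
        let (k , ∣gap∣≡x) = gap-onto x 1≤x x≤n ; (c , κc≡k) = onto k ; p = InDiag-diagRow (β + ε) c
        in diagRow (β + ε) c , c , p , gap A (κ c) , on-D₁ p , trans (cong (∣_∣ ∘ gap A) κc≡k) ∣gap∣≡x

    D₀∪D₂ : Fin n → Fin n → Set
    D₀∪D₂ i j = InDiag n β i j ⊎ InDiag n (β + 2 * ε) i j

    support-D₀∪D₂ : ∀ x → InSupport L D₀∪D₂ x ⇔ (n + 1 ≤ x × x ≤ 3 * n)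
    support-D₀∪D₂ x = mk⇔ to from
      where
      to : InSupport L D₀∪D₂ x → n + 1 ≤ x × x ≤ 3 * n
      to (r , c , inj₁ p , v , Lrc≡v , ∣v∣≡x) = subst (λ y → n + 1 ≤ y × y ≤ 3 * n) A≡x (range (κ c))
        where A≡x : A (κ c) ≡ x
              A≡x = trans (cong ∣_∣ (entry-unique (on-D₀ p) Lrc≡v)) ∣v∣≡x
      to (r , c , inj₂ p , v , Lrc≡v , ∣v∣≡x) =
        subst (λ y → n + 1 ≤ y × y ≤ 3 * n) mirror≡x (pairSum∸-range (range (sucMod (κ c))))
        where mirror≡x : mirror A (κ c) ≡ x
              mirror≡x = trans (sym (ℤ.∣-i∣≡∣i∣ (+ mirror A (κ c))))
                               (trans (cong ∣_∣ (entry-unique (on-D₂ p) Lrc≡v)) ∣v∣≡x)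
      from : n + 1 ≤ x × x ≤ 3 * n → InSupport L D₀∪D₂ x
      from (n+1≤x , x≤3n) with pairs-onto x n+1≤x x≤3n
      ... | k , inj₁ Ak≡x =
        let (c , κc≡k) = onto k ; p = InDiag-diagRow β c
        in diagRow β c , c , inj₁ p , + A (κ c) , on-D₀ p , trans (cong A κc≡k) Ak≡x
      ... | k , inj₂ Ak+x≡T =
        let (k₀ , k₀+1≡k) = sucMod-onto k ; (c , κc≡k₀) = onto k₀ ; p = InDiag-diagRow (β + 2 * ε) c
        in diagRow (β + 2 * ε) c , c , inj₂ p , - + mirror A (κ c) , on-D₂ p , (begin
          ∣ - + mirror A (κ c) ∣        ≡⟨ ℤ.∣-i∣≡∣i∣ (+ mirror A (κ c)) ⟩
          pairSum n ∸ A (sucMod (κ c)) ≡⟨ cong (λ k′ → pairSum n ∸ A (sucMod k′)) κc≡k₀ ⟩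
          pairSum n ∸ A (sucMod k₀)    ≡⟨ cong (λ k′ → pairSum n ∸ A k′) k₀+1≡k ⟩
          pairSum n ∸ A k              ≡⟨ cong (_∸ A k) Ak+x≡T ⟨
          A k + x ∸ A k                ≡⟨ ℕ.m+n∸m≡n (A k) x ⟩
          x                            ∎)
        where open ≡-Reasoning

    filled⇔diagonal : ∀ i j → Filled (L i j) ⇔ (InDiag n β i j ⊎ InDiag n (β + ε) i j ⊎ InDiag n (β + 2 * ε) i j)
    filled⇔diagonal i j = mk⇔ to from
      where
      to : Filled (L i j) → InDiag n β i j ⊎ InDiag n (β + ε) i j ⊎ InDiag n (β + 2 * ε) i j
      to (v , Lij≡v) with InDiag? β i j | InDiag? (β + ε) i j | InDiag? (β + 2 * ε) i j
      ... | yes p₀ | _      | _      = inj₁ p₀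
      ... | no _   | yes p₁ | _      = inj₂ (inj₁ p₁)
      ... | no _   | no _   | yes p₂ = inj₂ (inj₂ p₂)
      ... | no ¬p₀ | no ¬p₁ | no ¬p₂ with () ← trans (sym (off ¬p₀ ¬p₁ ¬p₂)) Lij≡v
      from : InDiag n β i j ⊎ InDiag n (β + ε) i j ⊎ InDiag n (β + 2 * ε) i j → Filled (L i j)
      from (inj₁ p₀)        = _ , on-D₀ p₀
      from (inj₂ (inj₁ p₁)) = _ , on-D₁ p₁
      from (inj₂ (inj₂ p₂)) = _ , on-D₂ p₂

    D₀-positive : ∀ i j v → InDiag n β i j → L i j ≡ just v → 0ℤ ℤ.< v
    D₀-positive i j v p Lij≡v = subst (0ℤ ℤ.<_) (entry-unique (on-D₀ p) Lij≡v) (+<+ 0<A)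
      where 0<A : 0 < A (κ j)
            0<A = ℕ.≤-trans (ℕ.m≤n+m 1 n) (proj₁ (range (κ j)))

    D₂-negative : ∀ i j v → InDiag n (β + 2 * ε) i j → L i j ≡ just v → v ℤ.< 0ℤ
    D₂-negative i j v p Lij≡v = subst (ℤ._< 0ℤ) (entry-unique (on-D₂ p) Lij≡v) (negative 0<mirror)
      where
      0<mirror : 0 < mirror A (κ j)
      0<mirror = ℕ.≤-trans (ℕ.m≤n+m 1 n) (proj₁ (pairSum∸-range (range (sucMod (κ j)))))
      negative : ∀ {m} → 1 ≤ m → - + m ℤ.< 0ℤ
      negative {suc m} _ = -<+

    props : Props n β ε L
    props = filled⇔diagonal , support-D₁ , support-D₀∪D₂ , D₀-positive , D₂-negative

    support⇒±entry : ∀ {S x} → InSupport L S x → ∃[ i ] ∃[ j ] (L i j ≡ just (+ x) ⊎ L i j ≡ just (- + x))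
    support⇒±entry {x = x} (i , j , _ , v , Lij≡v , ∣v∣≡x) =
      i , j , Sum.map (trans Lij≡v ∘ cong just) (trans Lij≡v ∘ cong just) (∣i∣≡x⇒i≡±x v x ∣v∣≡x)

    covers : ∀ x → 1 ≤ x → x ≤ n * 3 → ∃[ i ] ∃[ j ] (L i j ≡ just (+ x) ⊎ L i j ≡ just (- + x))
    covers x 1≤x x≤3n with x ℕ.≤? n
    ... | yes x≤n = support⇒±entry (Equivalence.from (support-D₁ x) (1≤x , x≤n))
    ... | no x≰n  = support⇒±entry (Equivalence.from (support-D₀∪D₂ x) (n+1≤x , x≤3n′))
      where n+1≤x : n + 1 ≤ x
            n+1≤x = subst (_≤ x) (ℕ.+-comm 1 n) (ℕ.≰⇒> x≰n)
            x≤3n′ : x ≤ 3 * n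
            x≤3n′ = subst (x ≤_) (ℕ.*-comm n 3) x≤3n

    heffter : IsHeffter n 3 L
    heffter = rowCount≡3 , colCount≡3 , divides-zero ∘ rowSum≡0 , divides-zero ∘ colSum≡0 , covers
      where divides-zero : ∀ {m i} → i ≡ 0ℤ → + m ∣ℤ i
            divides-zero {m} refl = m ∣0

interleave : {X : Set} → (ℕ → X) → (ℕ → X) → ℕ → X
interleave f g zero          = f zero
interleave f g (suc zero)    = g zero
interleave f g (suc (suc k)) = interleave (f ∘ suc) (g ∘ suc) k

interleave-even : ∀ {X : Set} (f g : ℕ → X) i → interleave f g (i + i) ≡ f i
interleave-even f g zero    = refl
interleave-even f g (suc i) rewrite ℕ.+-suc i i = interleave-even (f ∘ suc) (g ∘ suc) i

interleave-odd : ∀ {X : Set} (f g : ℕ → X) i → interleave f g (suc (i + i)) ≡ g i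
interleave-odd f g zero    = refl
interleave-odd f g (suc i) rewrite ℕ.+-suc i i = interleave-odd (f ∘ suc) (g ∘ suc) i

data Parity : ℕ → Set where
  even : ∀ i → Parity (i + i)
  odd  : ∀ i → Parity (suc (i + i))

parity : ∀ k → Parity k
parity zero          = even zero
parity (suc zero)    = odd zero
parity (suc (suc k)) with parity k
... | even i = subst Parity (cong suc (ℕ.+-suc i i)) (even (suc i))
... | odd i  = subst Parity (cong (suc ∘ suc) (ℕ.+-suc i i)) (odd (suc i))

odd≢even : ∀ i j → suc (i + i) ≢ j + j
odd≢even zero    zero    ()
odd≢even zero    (suc j) eq with () ← trans (ℕ.suc-injective eq) (ℕ.+-suc j j)
odd≢even (suc i) zero    ()
odd≢even (suc i) (suc j) eq = odd≢even i j (ℕ.suc-injective (begin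
  suc (suc (i + i))  ≡⟨ ℕ.+-suc (suc i) i ⟨
  suc i + suc i      ≡⟨ ℕ.suc-injective eq ⟩
  j + suc j          ≡⟨ ℕ.+-suc j j ⟩
  suc (j + j)        ∎))
  where open ≡-Reasoning

double-injective : ∀ {i j} → i + i ≡ j + j → i ≡ j
double-injective {i} {j} eq = ℕ.*-cancelˡ-≡ i j 2 (trans (twice i) (trans eq (sym (twice j))))
  where twice : ∀ m → 2 * m ≡ m + m
        twice = solve-∀

∸-from-+ : ∀ {a b m} → a + b ≡ m → m ∸ a ≡ b
∸-from-+ {a} {b} refl = ℕ.m+n∸m≡n a b

half-< : ∀ {i m} → i + i < m + m → i < m
half-< {i} {m} i+i<m+m = ℕ.≰⇒> (λ m≤i → ℕ.<⇒≱ i+i<m+m (ℕ.+-mono-≤ m≤i m≤i))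

module Zigzag (n : ℕ) where

  zigzag : ℕ → ℕ
  zigzag = interleave (n ∸_) suc

  zigzag-step : ∀ k d → suc k + d ≡ n → zigzag (suc k) + d ≡ zigzag k ⊎ zigzag k + d ≡ zigzag (suc k)
  zigzag-step k d k+1+d≡n with parity k
  ... | even i rewrite interleave-even (n ∸_) suc i | interleave-odd (n ∸_) suc i =
    inj₁ (sym (∸-from-+ {i} (trans (rearrange i d) k+1+d≡n)))
    where rearrange : ∀ i d → i + (suc i + d) ≡ suc (i + i) + d
          rearrange = solve-∀
  ... | odd i rewrite interleave-odd (n ∸_) suc i | interleave-even ((n ∸_) ∘ suc) (suc ∘ suc) i =
    inj₂ (sym (∸-from-+ {suc i} (trans (rearrange i d) k+1+d≡n)))
    where rearrange : ∀ i d → suc i + (suc i + d) ≡ suc (suc (i + i)) + d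
          rearrange = solve-∀

  module _ {m} (n≡m+m : n ≡ m + m) where

    m≤n : m ≤ n
    m≤n = subst (m ≤_) (sym n≡m+m) (ℕ.m≤m+n m m)

    zigzag-range : ∀ k → k < n → 1 ≤ zigzag k × zigzag k ≤ n
    zigzag-range k k<n with parity k
    ... | even i rewrite interleave-even (n ∸_) suc i =
      ℕ.m<n⇒0<n∸m (ℕ.<-≤-trans (half-< {i} {m} (subst (i + i <_) n≡m+m k<n)) m≤n) , ℕ.m∸n≤m n i
    ... | odd i rewrite interleave-odd (n ∸_) suc i =
      s≤s z≤n , ℕ.≤-trans (half-< {i} {m} (ℕ.<-trans (ℕ.n<1+n (i + i)) (subst (suc (i + i) <_) n≡m+m k<n))) m≤n

    zigzag-onto : ∀ x → 1 ≤ x → x ≤ n → ∃[ k ] k < n × zigzag k ≡ x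
    zigzag-onto (suc j) _ x≤n with suc j ℕ.≤? m
    ... | yes j<m = suc (j + j) , odd<n , interleave-odd (n ∸_) suc j
      where
      odd<n : suc (j + j) < n
      odd<n = subst (suc (j + j) <_) (sym n≡m+m)
                (subst (_≤ m + m) (cong suc (ℕ.+-suc j j)) (ℕ.+-mono-≤ j<m j<m))
    ... | no j≮m = i + i , even<n , trans (interleave-even (n ∸_) suc i) (ℕ.m∸[m∸n]≡n x≤n)
      where
      i = n ∸ suc j
      m<x : m < suc j
      m<x = ℕ.≰⇒> j≮m
      i<m : i < m
      i<m = ℕ.≰⇒> (λ m≤i → ℕ.<-irrefl (sym (trans (ℕ.m∸n+n≡m x≤n) n≡m+m)) (ℕ.+-mono-≤-< m≤i m<x))
      even<n : i + i < n
      even<n = subst (i + i <_) (sym n≡m+m) (ℕ.+-mono-< i<m i<m)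

-- t - a - a′ = ± v, stated without subtraction.
data Gap (t a a′ v : ℕ) : Set where
  below : a + a′ + v ≡ t → Gap t a a′ v
  above : a + a′ ≡ t + v → Gap t a a′ v

Gap-sym : ∀ {t a a′ v} → Gap t a a′ v → Gap t a′ a v
Gap-sym {a = a} {a′} {v} (below eq) = below (trans (cong (_+ v) (ℕ.+-comm a′ a)) eq)
Gap-sym {a = a} {a′} (above eq) = above (trans (ℕ.+-comm a′ a) eq)

∣Gap∣ : ∀ {t a a′ v} → Gap t a a′ v → ∣ + t ℤ.- + a ℤ.- + a′ ∣ ≡ v
∣Gap∣ {a = a} {a′} {v} (below refl) rewrite ℤ.pos-+ (a + a′) v | ℤ.pos-+ a a′ =
  cong ∣_∣ (identity (+ a) (+ a′) (+ v))
  where identity : ∀ x y z → x ℤ.+ y ℤ.+ z ℤ.- x ℤ.- y ≡ z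
        identity = ℤ-Solver.solve-∀
∣Gap∣ {t} {a} {a′} {v} (above eq) = begin
  ∣ + t ℤ.- + a ℤ.- + a′ ∣          ≡⟨ cong ∣_∣ (identity (+ t) (+ a) (+ a′)) ⟩
  ∣ + t ℤ.- (+ a ℤ.+ + a′) ∣        ≡⟨ cong (λ x → ∣ + t ℤ.- x ∣) a+a′≡t+v ⟩
  ∣ + t ℤ.- (+ t ℤ.+ + v) ∣         ≡⟨ cong ∣_∣ (cancel (+ t) (+ v)) ⟩
  ∣ - + v ∣                          ≡⟨ ℤ.∣-i∣≡∣i∣ (+ v) ⟩
  v                                  ∎
  where
  open ≡-Reasoning
  identity : ∀ t x y → t ℤ.- x ℤ.- y ≡ t ℤ.- (x ℤ.+ y)
  identity = ℤ-Solver.solve-∀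
  cancel : ∀ t v → t ℤ.- (t ℤ.+ v) ≡ ℤ.- v
  cancel = ℤ-Solver.solve-∀
  a+a′≡t+v : + a ℤ.+ + a′ ≡ + t ℤ.+ + v
  a+a′≡t+v = trans (sym (ℤ.pos-+ a a′)) (trans (cong +_ eq) (ℤ.pos-+ t v))

module Placement (n : ℕ) where

  -- the low and the high member of the pair {n + u, 3n + 1 - u}, whose sum is 4n + 1
  place : Bool → ℕ → ℕ
  place true  u = 3 * n + 1 ∸ u
  place false u = n + u

  high+u : ∀ {u} → u ≤ 3 * n + 1 → place true u + u ≡ 3 * n + 1
  high+u = ℕ.m∸n+n≡m

  high+low : ∀ {u} → u ≤ 3 * n + 1 → place true u + place false u ≡ pairSum n
  high+low {u} u≤ = begin
    place true u + (n + u)   ≡⟨ rearrange (place true u) n u ⟩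
    n + (place true u + u)   ≡⟨ cong (λ m → n + m) (high+u u≤) ⟩
    n + (3 * n + 1)          ≡⟨ total n ⟩
    pairSum n                ∎
    where
    open ≡-Reasoning
    rearrange : ∀ h n u → h + (n + u) ≡ n + (h + u)
    rearrange = solve-∀
    total : ∀ n → n + (3 * n + 1) ≡ 4 * n + 1
    total = solve-∀

  place-range : ∀ s {u} → 1 ≤ u → u ≤ n → n + 1 ≤ place s u × place s u ≤ 3 * n
  place-range false {u} 1≤u u≤n =
    ℕ.+-monoʳ-≤ n 1≤u ,
    ℕ.≤-trans (ℕ.+-monoʳ-≤ n u≤n) (ℕ.+-monoʳ-≤ n (ℕ.m≤m+n n (n + 0)))
  place-range true {u} 1≤u u≤n = lower , upper
    where
    open ℕ.≤-Reasoning
    lower : n + 1 ≤ 3 * n + 1 ∸ u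
    lower = begin
      n + 1              ≤⟨ ℕ.+-monoˡ-≤ 1 (ℕ.m≤m+n n (n + 0)) ⟩
      2 * n + 1          ≡⟨ ℕ.m+n∸m≡n n (2 * n + 1) ⟨
      n + (2 * n + 1) ∸ n ≡⟨ cong (_∸ n) (rearrange n) ⟩
      3 * n + 1 ∸ n      ≤⟨ ℕ.∸-monoʳ-≤ (3 * n + 1) u≤n ⟩
      3 * n + 1 ∸ u      ∎
      where rearrange : ∀ n → n + (2 * n + 1) ≡ 3 * n + 1
            rearrange = solve-∀
    upper : 3 * n + 1 ∸ u ≤ 3 * n
    upper = begin
      3 * n + 1 ∸ u      ≤⟨ ℕ.∸-monoʳ-≤ (3 * n + 1) 1≤u ⟩
      3 * n + 1 ∸ 1      ≡⟨ ℕ.m+n∸n≡m (3 * n) 1 ⟩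
      3 * n              ∎

  place-pairs : ∀ s {u x} → u ≤ 3 * n + 1 → x ≡ place false u ⊎ x ≡ place true u →
                place s u ≡ x ⊎ place s u + x ≡ pairSum n
  place-pairs false u≤ (inj₁ refl) = inj₁ refl
  place-pairs false {u} u≤ (inj₂ refl) = inj₂ (trans (ℕ.+-comm (place false u) (place true u)) (high+low u≤))
  place-pairs true  u≤ (inj₁ refl) = inj₂ (high+low u≤)
  place-pairs true  u≤ (inj₂ refl) = inj₁ refl

  pair-member : ∀ x → n + 1 ≤ x → x ≤ 3 * n → ∃[ u ] (1 ≤ u × u ≤ n) × (x ≡ place false u ⊎ x ≡ place true u)
  pair-member x n+1≤x x≤3n with x ≤? n + n
  ... | yes x≤2n = x ∸ n , (lower , upper) , inj₁ (sym (ℕ.m+[n∸m]≡n (ℕ.≤-trans (ℕ.m≤m+n n 1) n+1≤x)))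
    where
    lower : 1 ≤ x ∸ n
    lower = subst (_≤ x ∸ n) (ℕ.m+n∸m≡n n 1) (ℕ.∸-monoˡ-≤ n n+1≤x)
    upper : x ∸ n ≤ n
    upper = subst (x ∸ n ≤_) (ℕ.m+n∸m≡n n n) (ℕ.∸-monoˡ-≤ n x≤2n)
  ... | no x≰2n = 3 * n + 1 ∸ x , (lower , upper) , inj₂ (sym (ℕ.m∸[m∸n]≡n x≤3n+1))
    where
    x≤3n+1 : x ≤ 3 * n + 1
    x≤3n+1 = ℕ.≤-trans x≤3n (ℕ.m≤m+n (3 * n) 1)
    lower : 1 ≤ 3 * n + 1 ∸ x
    lower = ℕ.m<n⇒0<n∸m (subst (suc x ≤_) (ℕ.+-comm 1 (3 * n)) (s≤s x≤3n))
    upper : 3 * n + 1 ∸ x ≤ n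
    upper = subst (3 * n + 1 ∸ x ≤_) (trans (cong (_∸ suc (n + n)) (split n)) (ℕ.m+n∸m≡n (suc (n + n)) n))
                  (ℕ.∸-monoʳ-≤ (3 * n + 1) (ℕ.≰⇒> x≰2n))
      where split : ∀ n → 3 * n + 1 ≡ suc (n + n) + n
            split = solve-∀

  place-high-low : ∀ {u u′ d} → u ≤ 3 * n + 1 → u′ + d ≡ u ⊎ u + d ≡ u′ →
                   Gap (pairSum n) (place true u) (place false u′) d
  place-high-low {u} {u′} {d} u≤ (inj₁ u′+d≡u) = below (begin
    h + (n + u′) + d      ≡⟨ rearrange h n u′ d ⟩
    n + (h + (u′ + d))    ≡⟨ cong (λ x → n + (h + x)) u′+d≡u ⟩
    n + (h + u)           ≡⟨ cong (λ x → n + x) (high+u u≤) ⟩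
    n + (3 * n + 1)       ≡⟨ total n ⟩
    pairSum n             ∎)
    where
    open ≡-Reasoning
    h = place true u
    rearrange : ∀ h n u d → h + (n + u) + d ≡ n + (h + (u + d))
    rearrange = solve-∀
    total : ∀ n → n + (3 * n + 1) ≡ 4 * n + 1
    total = solve-∀
  place-high-low {u} {u′} {d} u≤ (inj₂ u+d≡u′) = above (begin
    h + (n + u′)          ≡⟨ cong (λ x → h + (n + x)) u+d≡u′ ⟨
    h + (n + (u + d))     ≡⟨ rearrange h n u d ⟩
    n + (h + u) + d       ≡⟨ cong (λ x → n + x + d) (high+u u≤) ⟩
    n + (3 * n + 1) + d   ≡⟨ total n d ⟩
    pairSum n + d         ∎)
    where
    open ≡-Reasoning
    h = place true u
    rearrange : ∀ h n u d → h + (n + (u + d)) ≡ n + (h + u) + d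
    rearrange = solve-∀
    total : ∀ n d → n + (3 * n + 1) + d ≡ 4 * n + 1 + d
    total = solve-∀

  place-mixed : ∀ s {u u′ d} → u ≤ 3 * n + 1 → u′ ≤ 3 * n + 1 → u′ + d ≡ u ⊎ u + d ≡ u′ →
                Gap (pairSum n) (place s u) (place (not s) u′) d
  place-mixed true  u≤ u′≤ step = place-high-low u≤ step
  place-mixed false u≤ u′≤ step = Gap-sym (place-high-low u′≤ (swap step))

  place-high-high : ∀ {u u′ d} → u ≤ 3 * n + 1 → u′ ≤ 3 * n + 1 → u + u′ + d ≡ 2 * n + 1 →
                    Gap (pairSum n) (place true u) (place true u′) d
  place-high-high {u} {u′} {d} u≤ u′≤ sum≡ = above (ℕ.+-cancelʳ-≡ (u + u′) _ _ (begin
    h + h′ + (u + u′)        ≡⟨ rearrange h h′ u u′ ⟩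
    (h + u) + (h′ + u′)      ≡⟨ cong₂ _+_ (high+u u≤) (high+u u′≤) ⟩
    (3 * n + 1) + (3 * n + 1) ≡⟨ total n ⟩
    4 * n + 1 + (2 * n + 1)  ≡⟨ cong (λ x → 4 * n + 1 + x) sum≡ ⟨
    4 * n + 1 + (u + u′ + d) ≡⟨ shuffle (4 * n + 1) u u′ d ⟩
    pairSum n + d + (u + u′) ∎))
    where
    open ≡-Reasoning
    h = place true u
    h′ = place true u′
    rearrange : ∀ h h′ u u′ → h + h′ + (u + u′) ≡ (h + u) + (h′ + u′)
    rearrange = solve-∀
    total : ∀ n → (3 * n + 1) + (3 * n + 1) ≡ 4 * n + 1 + (2 * n + 1)
    total = solve-∀
    shuffle : ∀ t u u′ d → t + (u + u′ + d) ≡ t + d + (u + u′)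
    shuffle = solve-∀

module ZigzagSequence (q : ℕ) .{{_ : NonZero q}} where

  n : ℕ
  n = q * 4

  instance
    n≢0 : NonZero n
    n≢0 = ℕ.m*n≢0 q 4

  open Zigzag n
  open Placement n

  n≡4q : n ≡ (q + q) + (q + q)
  n≡4q = rearrange q
    where rearrange : ∀ q → q * 4 ≡ (q + q) + (q + q)
          rearrange = solve-∀

  -- Sides alternate, except that positions 2q - 2, 2q - 1 and positions n - 1, 0 are both high.
  evenHigh? : ℕ → Bool
  evenHigh? i with i <? q
  ... | yes _ = true
  ... | no _  = false

  oddHigh? : ℕ → Bool
  oddHigh? i with q ≤? suc i
  ... | yes _ = true
  ... | no _  = false

  high? : ℕ → Bool
  high? = interleave evenHigh? oddHigh?

  sequence : ℕ → ℕ
  sequence k = place (high? k) (zigzag k)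

  high?-flip : ∀ k → suc (suc k) ≢ q + q → high? (suc k) ≡ not (high? k)
  high?-flip k ne with parity k
  ... | even i rewrite interleave-odd evenHigh? oddHigh? i | interleave-even evenHigh? oddHigh? i
    with i <? q | q ≤? suc i
  ...   | yes i<q | yes q≤i+1 = ⊥-elim (ne (trans (cong suc (sym (ℕ.+-suc i i))) (cong₂ _+_ i+1≡q i+1≡q)))
    where i+1≡q : suc i ≡ q
          i+1≡q = ℕ.≤-antisym i<q q≤i+1
  ...   | yes _   | no _      = refl
  ...   | no _    | yes _     = refl
  ...   | no i≮q  | no q≰i+1  = ⊥-elim (q≰i+1 (ℕ.≤-trans (ℕ.≮⇒≥ i≮q) (ℕ.n≤1+n i)))
  high?-flip k ne | odd i rewrite interleave-odd evenHigh? oddHigh? i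
                                | interleave-even (evenHigh? ∘ suc) (oddHigh? ∘ suc) i
    with suc i <? q | q ≤? suc i
  ...   | yes i+1<q | yes q≤i+1 = ⊥-elim (ℕ.<⇒≱ i+1<q q≤i+1)
  ...   | yes _     | no _      = refl
  ...   | no _      | yes _     = refl
  ...   | no i+1≮q  | no q≰i+1  = ⊥-elim (q≰i+1 (ℕ.≮⇒≥ i+1≮q))

  evenHigh?-< : ∀ {i} → i < q → evenHigh? i ≡ true
  evenHigh?-< {i} i<q with i <? q
  ... | yes _  = refl
  ... | no i≮q = ⊥-elim (i≮q i<q)

  oddHigh?-≤ : ∀ {i} → q ≤ suc i → oddHigh? i ≡ true
  oddHigh?-≤ {i} q≤i+1 with q ≤? suc i
  ... | yes _    = refl
  ... | no q≰i+1 = ⊥-elim (q≰i+1 q≤i+1)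

  q≤n : q ≤ n
  q≤n = ℕ.m≤m*n q 4

  2q≤n : q + q ≤ n
  2q≤n = subst (q + q ≤_) (sym n≡4q) (ℕ.m≤m+n (q + q) (q + q))

  n≤3n+1 : n ≤ 3 * n + 1
  n≤3n+1 = ℕ.≤-trans (ℕ.m≤n*m n 3) (ℕ.m≤m+n (3 * n) 1)

  zigzag≤ : ∀ k → k < n → zigzag k ≤ 3 * n + 1
  zigzag≤ k k<n = ℕ.≤-trans (proj₂ (zigzag-range {q + q} n≡4q k k<n)) n≤3n+1

  gap-regular : ∀ k d → suc k + d ≡ n → suc k < n → suc (suc k) ≢ q + q →
                Gap (pairSum n) (sequence k) (sequence (suc k)) d
  gap-regular k d k+1+d≡n k+1<n ne rewrite high?-flip k ne =
    place-mixed (high? k) (zigzag≤ k (ℕ.<-trans (ℕ.n<1+n k) k+1<n)) (zigzag≤ (suc k) k+1<n)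
                (zigzag-step k d k+1+d≡n)

  gap-switch : ∀ i → suc i ≡ q → Gap (pairSum n) (sequence (i + i)) (sequence (suc (i + i))) n
  gap-switch i i+1≡q
    rewrite interleave-even evenHigh? oddHigh? i | interleave-odd evenHigh? oddHigh? i
          | evenHigh?-< (subst (i <_) i+1≡q (ℕ.n<1+n i)) | oddHigh?-≤ (ℕ.≤-reflexive (sym i+1≡q))
          | interleave-even (n ∸_) suc i | interleave-odd (n ∸_) suc i
    = place-high-high (ℕ.≤-trans (ℕ.m∸n≤m n i) n≤3n+1) (ℕ.≤-trans i+1≤n n≤3n+1) sum≡
    where
    i+1≤n : suc i ≤ n
    i+1≤n = subst (_≤ n) (sym i+1≡q) q≤n
    i≤n : i ≤ n
    i≤n = ℕ.≤-trans (ℕ.n≤1+n i) i+1≤n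
    sum≡ : n ∸ i + suc i + n ≡ 2 * n + 1
    sum≡ = trans (cong (_+ n) (trans (ℕ.+-suc (n ∸ i) i) (cong suc (ℕ.m∸n+n≡m i≤n)))) (double n)
      where double : ∀ n → suc n + n ≡ 2 * n + 1
            double = solve-∀

  gap-wrap : ∀ i → suc i ≡ q + q → Gap (pairSum n) (sequence (suc (i + i))) (sequence 0) (suc (q + q))
  gap-wrap i i+1≡2q
    rewrite interleave-odd evenHigh? oddHigh? i | oddHigh?-≤ (subst (q ≤_) (sym i+1≡2q) (ℕ.m≤m+n q q))
          | evenHigh?-< {0} (ℕ.>-nonZero⁻¹ q) | interleave-odd (n ∸_) suc i | i+1≡2q
    = place-high-high (ℕ.≤-trans 2q≤n n≤3n+1) n≤3n+1 (total q)
    where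
    total : ∀ q → q + q + q * 4 + suc (q + q) ≡ 2 * (q * 4) + 1
    total = solve-∀

  2q+1≤n : suc (q + q) ≤ n
  2q+1≤n = ≡.subst₂ _≤_ (ℕ.+-comm (q + q) 1) (sym n≡4q)
             (ℕ.+-monoʳ-≤ (q + q) (ℕ.≤-trans (ℕ.>-nonZero⁻¹ q) (ℕ.m≤m+n q q)))

  Step : ℕ → ℕ → Set
  Step k v = k < n × Gap (pairSum n) (sequence k) (sequence (suc k % n)) v

  step-regular : ∀ k d → suc k + d ≡ n → 0 < d → suc (suc k) ≢ q + q → Step k d
  step-regular k d k+1+d≡n 0<d ne =
    ℕ.<-trans (ℕ.n<1+n k) k+1<n ,
    subst (λ j → Gap (pairSum n) (sequence k) (sequence j) d) (sym (m<n⇒m%n≡m k+1<n))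
          (gap-regular k d k+1+d≡n k+1<n ne)
    where k+1<n = subst (suc k <_) k+1+d≡n (ℕ.m<m+n (suc k) 0<d)

  step-switch : ∀ i → suc i ≡ q → Step (i + i) n
  step-switch i i+1≡q =
    ℕ.<-trans (ℕ.n<1+n (i + i)) k+1<n ,
    subst (λ j → Gap (pairSum n) (sequence (i + i)) (sequence j) n) (sym (m<n⇒m%n≡m k+1<n)) (gap-switch i i+1≡q)
    where
    k+1<n : suc (i + i) < n
    k+1<n = ℕ.<-≤-trans (subst (suc (i + i) <_) (cong₂ _+_ i+1≡q i+1≡q) (s≤s (ℕ.≤-reflexive (sym (ℕ.+-suc i i)))))
                        2q≤n

  step-wrap : ∀ i → suc i ≡ q + q → Step (suc (i + i)) (suc (q + q))
  step-wrap i i+1≡2q =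
    ℕ.≤-reflexive k+1≡n ,
    subst (λ j → Gap (pairSum n) (sequence (suc (i + i))) (sequence j) (suc (q + q)))
          (sym (trans (cong (_% n) k+1≡n) (n%n≡0 n))) (gap-wrap i i+1≡2q)
    where
    k+1≡n : suc (suc (i + i)) ≡ n
    k+1≡n = trans (cong suc (sym (ℕ.+-suc i i))) (trans (cong₂ _+_ i+1≡2q i+1≡2q) (sym n≡4q))

  step-regular-at : ∀ k → suc k < n → suc (suc k) ≢ q + q → ∃[ v ] (1 ≤ v × v ≤ n) × Step k v
  step-regular-at k k+1<n ne with ℕ.m≤n⇒∃[o]m+o≡n k+1<n
  ... | o , k+2+o≡n = suc o , (s≤s z≤n , subst (suc o ≤_) k+1+d≡n (ℕ.m≤n+m (suc o) (suc k))) ,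
                      step-regular k (suc o) k+1+d≡n (s≤s z≤n) ne
    where k+1+d≡n : suc k + suc o ≡ n
          k+1+d≡n = trans (ℕ.+-suc (suc k) o) k+2+o≡n

  step-at : ∀ k → k < n → ∃[ v ] (1 ≤ v × v ≤ n) × Step k v
  step-at k k<n with parity k
  ... | even i with suc i ℕ.≟ q
  ...   | yes i+1≡q = n , (ℕ.>-nonZero⁻¹ n , ℕ.≤-refl) , step-switch i i+1≡q
  ...   | no i+1≢q  = step-regular-at (i + i) (ℕ.≤∧≢⇒< k<n (odd≢even i (q + q) ∘ flip trans n≡4q))
                        (i+1≢q ∘ double-injective ∘ trans (cong suc (ℕ.+-suc i i)))
  step-at k k<n | odd i with suc (suc (i + i)) ℕ.≟ n
  ...   | yes k+1≡n = suc (q + q) , (s≤s z≤n , 2q+1≤n) ,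
                      step-wrap i (double-injective (trans (cong suc (ℕ.+-suc i i)) (trans k+1≡n n≡4q)))
  ...   | no k+1≢n  = step-regular-at (suc (i + i)) (ℕ.≤∧≢⇒< k<n k+1≢n)
                        (odd≢even (suc i) q ∘ trans (cong (suc ∘ suc) (ℕ.+-suc i i)))

  step-hit : ∀ x → 1 ≤ x → x ≤ n → ∃[ k ] Step k x
  step-hit x 1≤x x≤n with x ℕ.≟ n | x ℕ.≟ suc (q + q)
  ... | yes refl | _        = ℕ.pred q + ℕ.pred q , step-switch (ℕ.pred q) (ℕ.suc-pred q)
  ... | no _     | yes refl = suc (i + i) , step-wrap i (cong (_+ q) (ℕ.suc-pred q))
    where i = ℕ.pred q + q
  ... | no x≢n   | no x≢2q+1 with ℕ.m≤n⇒∃[o]m+o≡n x≤n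
  ...   | zero  , x+0≡n   = ⊥-elim (x≢n (trans (sym (ℕ.+-identityʳ x)) x+0≡n))
  ...   | suc k , x+k+1≡n = k , step-regular k x k+1+x≡n 1≤x ne
    where
    k+1+x≡n : suc k + x ≡ n
    k+1+x≡n = trans (ℕ.+-comm (suc k) x) x+k+1≡n
    ne : suc (suc k) ≢ q + q
    ne k+2≡2q = x≢2q+1 (ℕ.+-cancelˡ-≡ (q + q) x (suc (q + q)) (begin
      q + q + x            ≡⟨ cong (_+ x) k+2≡2q ⟨
      suc (suc k) + x      ≡⟨ cong suc k+1+x≡n ⟩
      suc n                ≡⟨ cong suc n≡4q ⟩
      suc (q + q + (q + q)) ≡⟨ ℕ.+-suc (q + q) (q + q) ⟨
      q + q + suc (q + q)  ∎))
      where open ≡-Reasoning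

  A : Fin n → ℕ
  A k = sequence (toℕ k)

  ∣gap∣≡ : ∀ k {v} → Gap (pairSum n) (sequence (toℕ k)) (sequence (suc (toℕ k) % n)) v → ∣ gap n A k ∣ ≡ v
  ∣gap∣≡ k {v} g = ∣Gap∣ (subst (λ j → Gap (pairSum n) (A k) (sequence j) v) (sym (toℕ-sucMod k)) g)
    where open Modular n using (toℕ-sucMod)

  seed : IsHeffterSeed n A
  seed = record { range = range ; gap-range = gap-range ; gap-onto = gap-onto ; pairs-onto = pairs-onto }
    where
    range : ∀ k → n + 1 ≤ A k × A k ≤ 3 * n
    range k = let (1≤u , u≤n) = zigzag-range {q + q} n≡4q (toℕ k) (toℕ<n k)
              in place-range (high? (toℕ k)) 1≤u u≤n
    gap-range : ∀ k → 1 ≤ ∣ gap n A k ∣ × ∣ gap n A k ∣ ≤ n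
    gap-range k = let (v , bounds , _ , g) = step-at (toℕ k) (toℕ<n k)
                  in subst (λ y → 1 ≤ y × y ≤ n) (sym (∣gap∣≡ k g)) bounds
    gap-onto : ∀ x → 1 ≤ x → x ≤ n → ∃[ k ] ∣ gap n A k ∣ ≡ x
    gap-onto x 1≤x x≤n =
      let (k , k<n , g) = step-hit x 1≤x x≤n
      in fromℕ< k<n , ∣gap∣≡ (fromℕ< k<n)
           (subst (λ j → Gap (pairSum n) (sequence j) (sequence (suc j % n)) x) (sym (toℕ-fromℕ< k<n)) g)
    pairs-onto : ∀ x → n + 1 ≤ x → x ≤ 3 * n → ∃[ k ] (A k ≡ x ⊎ A k + x ≡ pairSum n)
    pairs-onto x n+1≤x x≤3n =
      let (u , (1≤u , u≤n) , x∈pair) = pair-member x n+1≤x x≤3n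
          (k , k<n , zk≡u) = zigzag-onto {q + q} n≡4q u 1≤u u≤n
          member = place-pairs (high? k) (ℕ.≤-trans u≤n n≤3n+1) x∈pair
      in fromℕ< k<n , subst (λ j → sequence j ≡ x ⊎ sequence j + x ≡ pairSum n) (sym (toℕ-fromℕ< k<n))
                        (subst (λ u′ → place (high? k) u′ ≡ x ⊎ place (high? k) u′ + x ≡ pairSum n)
                               (sym zk≡u) member)

inverse-mod : ∀ n .{{_ : NonZero n}} ε → gcd n ε ≡ 1 → ∃[ e ] (ε * e) % n ≡ 1 % n
inverse-mod (suc m) ε gcd≡1 with Bézout.identity (subst (GCD (suc m) ε) gcd≡1 (gcd-GCD (suc m) ε))
... | Bézout.-+ x y 1+xn≡yε = y , (begin
  (ε * y) % suc m              ≡⟨ cong (_% suc m) (trans (ℕ.*-comm ε y) (sym 1+xn≡yε)) ⟩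
  (1 + x * suc m) % suc m      ≡⟨ [m+kn]%n≡m%n 1 x (suc m) ⟩
  1 % suc m                    ∎)
  where open ≡-Reasoning
... | Bézout.+- x y 1+yε≡xn = y * m , (begin
  (ε * (y * m)) % suc m                 ≡⟨ [m+n]%n≡m%n (ε * (y * m)) (suc m) ⟨
  (ε * (y * m) + suc m) % suc m         ≡⟨ cong (_% suc m) (rearrange ε y m) ⟩
  (1 + m * (1 + y * ε)) % suc m         ≡⟨ cong (λ z → (1 + m * z) % suc m) 1+yε≡xn ⟩
  (1 + m * (x * suc m)) % suc m         ≡⟨ cong (_% suc m) (reassociate m x) ⟩
  (1 + m * x * suc m) % suc m           ≡⟨ [m+kn]%n≡m%n 1 (m * x) (suc m) ⟩
  1 % suc m                             ∎)
  where
  open ≡-Reasoning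
  rearrange : ∀ ε y m → ε * (y * m) + suc m ≡ 1 + m * (1 + y * ε)
  rearrange = solve-∀
  reassociate : ∀ m x → 1 + m * (x * suc m) ≡ 1 + m * x * suc m
  reassociate = solve-∀

module _ (n : ℕ) .{{_ : NonZero n}} {ε e : ℕ} (εe≡1 : (ε * e) % n ≡ 1 % n) where

  open Modular n
  open ≡-Reasoning

  scale : Fin n → Fin n
  scale c = fromℕ< (m%n<n (toℕ c * e) n)

  scale-IsLabelling : IsLabelling n ε scale
  scale-IsLabelling = record { step = step ; onto = onto }
    where
    step : ∀ c c′ → (toℕ c + ε) % n ≡ toℕ c′ → scale c′ ≡ sucMod (scale c)
    step c c′ c+ε≡c′ = toℕ-injective (begin
      toℕ (scale c′)                 ≡⟨ toℕ-fromℕ< (m%n<n (toℕ c′ * e) n) ⟩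
      (toℕ c′ * e) % n               ≡⟨ cong (λ x → (x * e) % n) c+ε≡c′ ⟨
      ((toℕ c + ε) % n * e) % n      ≡⟨ %-mulʳ e (m%n%n≡m%n (toℕ c + ε) n) ⟩
      ((toℕ c + ε) * e) % n          ≡⟨ cong (_% n) (ℕ.*-distribʳ-+ e (toℕ c) ε) ⟩
      (toℕ c * e + ε * e) % n        ≡⟨ %-addˡ (toℕ c * e) εe≡1 ⟩
      (toℕ c * e + 1) % n            ≡⟨ cong (_% n) (ℕ.+-comm (toℕ c * e) 1) ⟩
      suc (toℕ c * e) % n            ≡⟨ %-addˡ 1 (m%n%n≡m%n (toℕ c * e) n) ⟨
      suc ((toℕ c * e) % n) % n      ≡⟨ cong (λ x → suc x % n) (toℕ-fromℕ< (m%n<n (toℕ c * e) n)) ⟨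
      suc (toℕ (scale c)) % n        ≡⟨ toℕ-sucMod (scale c) ⟨
      toℕ (sucMod (scale c))         ∎)
    onto : ∀ k → ∃[ c ] scale c ≡ k
    onto k = c , toℕ-injective (begin
      toℕ (scale c)              ≡⟨ toℕ-fromℕ< (m%n<n (toℕ c * e) n) ⟩
      (toℕ c * e) % n            ≡⟨ cong (λ x → (x * e) % n) (toℕ-fromℕ< (m%n<n (toℕ k * ε) n)) ⟩
      ((toℕ k * ε) % n * e) % n  ≡⟨ %-mulʳ e (m%n%n≡m%n (toℕ k * ε) n) ⟩
      (toℕ k * ε * e) % n        ≡⟨ cong (_% n) (rearrange (toℕ k) ε e) ⟩
      (ε * e * toℕ k) % n        ≡⟨ %-mulʳ (toℕ k) εe≡1 ⟩
      (1 * toℕ k) % n            ≡⟨ cong (_% n) (ℕ.*-identityˡ (toℕ k)) ⟩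
      toℕ k % n                  ≡⟨ m<n⇒m%n≡m (toℕ<n k) ⟩
      toℕ k                      ∎)
      where
      c = fromℕ< (m%n<n (toℕ k * ε) n)
      rearrange : ∀ k ε e → k * ε * e ≡ ε * e * k
      rearrange = solve-∀

corollary4p3 : (n ε : ℕ) .{{_ : NonZero n}} → 4 ∣ n → 0 < ε → gcd n ε ≡ 1 →
    (β : ℕ) → β + 2 * ε + 1 ≤ n →
    ∃[ L ] (IsHeffter n 3 L × Props n β ε L
            × IsHeffter n 3 (shift L) × Props n β ε (shift L))
corollary4p3 _ ε (divides zero refl) 0<ε gcd≡1 β bound with () ← ℕ.m+n≤o⇒n≤o (β + 2 * ε) bound
corollary4p3 _ ε (divides (suc p) refl) 0<ε gcd≡1 β bound =
  L , L₀.heffter , L₀.props , L₁.heffter , L₁.props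
  where
  open ZigzagSequence (suc p)
  inverse : ∃[ e ] (ε * e) % n ≡ 1 % n
  inverse = inverse-mod n ε gcd≡1
  κ : Fin n → Fin n
  κ = scale n {ε} (proj₂ inverse)
  lab : IsLabelling n ε κ
  lab = scale-IsLabelling n {ε} (proj₂ inverse)
  L : Array n
  L = layout n β ε A κ
  lay : IsLayout n β ε A κ L
  lay = DisjointDiagonals.layout-IsLayout n {β} 0<ε bound A κ
  module L₀ = LayoutProperties n {β} 0<ε bound seed lab lay
  module L₁ = LayoutProperties n {β} 0<ε bound seed (IsLabelling-shift n lab) (IsLayout-shift n lay)
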